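{- Let $r$ be a positive integer and let the numbers of cyclic derangements $d_{n,r}$ be defined by $\frac{e^{ -z}}{1-rz}=\sum_{n\geq0}d_{n,r}\frac{z^{n}}{n!}$. Then for every integer $n\ge0$, \[\det\left(d_{i+j-2,r}\right)_{1\leq i,j\leq n+1}=r^{n(n+1)}\left(\prod_{k=1}^{n}k!\right)^{2}.\]
   Context: The generating function identity is an identity of formal power series in $z$. -}

module Defs where

open import Data.Nat as ℕ using (ℕ; zero; suc; _!; _∸_)
open import Data.Nat.Properties using (_!≢0)
open import Data.Integer as ℤ using (ℤ)
open import Data.Rational as ℚ using (ℚ)
open import Data.Fin using (Fin; zero; suc; punchIn)

Σℚ : (n : ℕ) → (ℕ → ℚ) → ℚ
Σℚ zero    f = ℚ.0ℚ
Σℚ (suc n) f = Σℚ n f ℚ.+ f n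

ΣFin : (n : ℕ) → (Fin n → ℤ) → ℤ
ΣFin zero    f = ℤ.0ℤ
ΣFin (suc n) f = f zero ℤ.+ ΣFin n (λ i → f (suc i))

-- Formal power series over ℚ in z: a series is its sequence of
-- ordinary coefficients, f = Σ_n f n · z^n.

FPS : Set
FPS = ℕ → ℚ

_*ₛ_ : FPS → FPS → FPS
(f *ₛ g) n = Σℚ (suc n) (λ k → f k ℚ.* g (n ∸ k))

_^ℚ_ : ℚ → ℕ → ℚ
q ^ℚ zero  = ℚ.1ℚ
q ^ℚ suc n = q ℚ.* (q ^ℚ n)

inv! : ℕ → ℚ
inv! n = ℤ.+ 1 ℚ./ (n !)
  where instance _ = n !≢0

expNeg : FPS
expNeg n = ((ℚ.- ℚ.1ℚ) ^ℚ n) ℚ.* inv! n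

-- 1/(1 - r z) = Σ_n r^n z^n  (the inverse of 1 - rz in ℚ[[z]])
geom : ℕ → FPS
geom r n = (ℤ.+ r ℚ./ 1) ^ℚ n

-- The EGF identity  e^{-z}/(1-rz) = Σ_n d n z^n/n!  for a sequence d,
-- compared coefficientwise.
HasEGF : ℕ → (ℕ → ℤ) → Set
HasEGF r d = ∀ n → (d n ℚ./ 1) ℚ.* inv! n ≡ (expNeg *ₛ geom r) n
  where open import Relation.Binary.PropositionalEquality using (_≡_)

sgn : ℕ → ℤ
sgn zero    = ℤ.1ℤ
sgn (suc k) = ℤ.- sgn k

toℕ' : ∀ {n} → Fin n → ℕ
toℕ' zero    = zero
toℕ' (suc i) = suc (toℕ' i)

det : (n : ℕ) → (Fin n → Fin n → ℤ) → ℤ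
det zero    M = ℤ.1ℤ
det (suc n) M =
  ΣFin (suc n) λ j →
    sgn (toℕ' j) ℤ.* (M zero j ℤ.* det n (λ a b → M (suc a) (punchIn j b)))

superfact : ℕ → ℕ
superfact zero    = 1
superfact (suc n) = superfact n ℕ.* (suc n !)

{-# OPTIONS --safe #-}
-- By its exponential generating function, d satisfies d 0 = 1 and d n = r n d (n - 1) + (-1)ⁿ.
-- Read d as the moments d m = ℒ(yᵐ) of a linear functional ℒ on ℤ[y] and let T = 1 - r d/dy.
-- The recurrence says ℒ(T h) = h(-1) and ℒ(yʲ⁺¹ T h) = r (j + 1) ℒ(yʲ h) + (-1)ʲ⁺¹ h(-1).
-- Since Tⁱ (1 + y)ᵏ still vanishes at -1 for i < k, the monic polynomials pₖ = Tᵏ (1 + y)ᵏ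
-- satisfy ℒ(yʲ pₖ) = 0 for j < k and ℒ(yᵏ pₖ) = rᵏ k! ℒ((1 + y)ᵏ) = (rᵏ k!)².  Multiplying the
-- Hankel matrix on the left by the unit lower triangular coefficient matrix of p₀, …, pₙ thus
-- keeps its determinant and makes it upper triangular with diagonal entries (rᵏ k!)².
module Submission where

open import Defs
open import Data.Nat as ℕ using (ℕ; suc; _^_; _≥_)
open import Data.Integer as ℤ using (ℤ; +_)
open import Data.Fin using (toℕ)
open import Relation.Binary.PropositionalEquality using (_≡_)

open import Data.Nat using (zero; _!; _∸_; _≤_; _<_; z≤n; s≤s)
import Data.Nat.Properties as ℕP
open import Data.Nat.Properties using (_!≢0)
open import Data.Nat.GeneralisedArithmetic using (fold)
open import Data.Nat.Tactic.RingSolver using () renaming (solve-∀ to ℕ-solve-∀)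
open import Data.Integer using (_+_; _*_; -_; _-_; 0ℤ; 1ℤ)
import Data.Integer.Properties as ℤP
open import Data.Integer.Tactic.RingSolver using (solve-∀)
open import Data.Rational as ℚ using (ℚ; toℚᵘ; fromℚᵘ)
import Data.Rational.Properties as ℚP
import Data.Rational.Unnormalised as ℚᵘ
open ℚᵘ using (mkℚᵘ; *≡*)
import Data.Rational.Unnormalised.Properties as ℚᵘP
open import Data.Rational.Solver using (module +-*-Solver)
open import Data.Fin as Fin using (Fin; zero; suc; punchIn; lift)
import Data.Fin.Properties as FinP
open import Data.Vec.Functional using (Vector; _∷_)
open import Data.Product using (_×_; _,_)
open import Algebra.Bundles using (Monoid; CommutativeMonoid)
open import Algebra.Properties.CommutativeSemigroup
  (CommutativeMonoid.commutativeSemigroup ℚP.*-1-commutativeMonoid) using (x∙yz≈y∙xz)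
import Algebra.Properties.Monoid.Sum as MonoidSum
open import Algebra.Properties.Semiring.Sum ℤP.+-*-semiring
  using (sum; sum-syntax; sum-cong-≗; sum-replicate-zero; ∑-distrib-+; *-distribˡ-sum)
open import Algebra.Properties.Monoid.Sum ℤP.*-1-monoid
  using () renaming (sum to product; sum-cong-≗ to product-cong)
open import Function using (_∘′_)
open import Relation.Binary.Core using (_Preserves_⟶_)
open import Relation.Binary.PropositionalEquality
  using (refl; sym; trans; cong; cong₂; _≗_; module ≡-Reasoning)

-- The recurrence for d

_/1 : ℤ → ℚ
i /1 = i ℚ./ 1

fromℚᵘ-homo-+ : ∀ p q → fromℚᵘ (p ℚᵘ.+ q) ≡ fromℚᵘ p ℚ.+ fromℚᵘ q
fromℚᵘ-homo-+ p q = ℚP.toℚᵘ-injective (begin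
  toℚᵘ (fromℚᵘ (p ℚᵘ.+ q))             ≈⟨ ℚP.toℚᵘ-fromℚᵘ (p ℚᵘ.+ q) ⟩
  p ℚᵘ.+ q                             ≈⟨ ℚᵘP.+-cong (ℚP.toℚᵘ-fromℚᵘ p) (ℚP.toℚᵘ-fromℚᵘ q) ⟨
  toℚᵘ (fromℚᵘ p) ℚᵘ.+ toℚᵘ (fromℚᵘ q) ≈⟨ ℚP.toℚᵘ-homo-+ (fromℚᵘ p) (fromℚᵘ q) ⟨
  toℚᵘ (fromℚᵘ p ℚ.+ fromℚᵘ q)         ∎)
  where open ℚᵘP.≃-Reasoning

fromℚᵘ-homo-* : ∀ p q → fromℚᵘ (p ℚᵘ.* q) ≡ fromℚᵘ p ℚ.* fromℚᵘ q
fromℚᵘ-homo-* p q = ℚP.toℚᵘ-injective (begin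
  toℚᵘ (fromℚᵘ (p ℚᵘ.* q))             ≈⟨ ℚP.toℚᵘ-fromℚᵘ (p ℚᵘ.* q) ⟩
  p ℚᵘ.* q                             ≈⟨ ℚᵘP.*-cong (ℚP.toℚᵘ-fromℚᵘ p) (ℚP.toℚᵘ-fromℚᵘ q) ⟨
  toℚᵘ (fromℚᵘ p) ℚᵘ.* toℚᵘ (fromℚᵘ q) ≈⟨ ℚP.toℚᵘ-homo-* (fromℚᵘ p) (fromℚᵘ q) ⟨
  toℚᵘ (fromℚᵘ p ℚ.* fromℚᵘ q)         ∎)
  where open ℚᵘP.≃-Reasoning

/1-homo-+ : ∀ i j → (i + j) /1 ≡ i /1 ℚ.+ j /1
/1-homo-+ i j = trans (ℚP.fromℚᵘ-cong {mkℚᵘ (i + j) 0} {mkℚᵘ i 0 ℚᵘ.+ mkℚᵘ j 0} (*≡* (cross-multiplied i j)))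
                      (fromℚᵘ-homo-+ (mkℚᵘ i 0) (mkℚᵘ j 0))
  where
  cross-multiplied : ∀ i j → (i + j) * + 1 ≡ (i * + 1 + j * + 1) * + 1
  cross-multiplied = solve-∀

/1-homo-* : ∀ i j → (i * j) /1 ≡ i /1 ℚ.* j /1
/1-homo-* i j = fromℚᵘ-homo-* (mkℚᵘ i 0) (mkℚᵘ j 0)

/1-injective : ∀ {i j} → i /1 ≡ j /1 → i ≡ j
/1-injective {i} {j} eq with ℚᵘP.≃-trans (ℚᵘP.≃-sym (ℚP.toℚᵘ-fromℚᵘ (mkℚᵘ i 0)))
                                (ℚᵘP.≃-trans (ℚP.toℚᵘ-cong eq) (ℚP.toℚᵘ-fromℚᵘ (mkℚᵘ j 0)))
... | *≡* i*1≡j*1 = trans (sym (ℤP.*-identityʳ i)) (trans i*1≡j*1 (ℤP.*-identityʳ j))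

/1-*-inverse : ∀ k .{{_ : ℕ.NonZero k}} → (+ k) /1 ℚ.* (+ 1 ℚ./ k) ≡ ℚ.1ℚ
/1-*-inverse (suc k) = trans (sym (fromℚᵘ-homo-* (mkℚᵘ (+ suc k) 0) (mkℚᵘ (+ 1) k)))
                             (ℚP.fromℚᵘ-cong (ℚᵘP.*-inverseʳ (mkℚᵘ (+ suc k) 0)))

-1^n≡sgn : ∀ n → (ℚ.- ℚ.1ℚ) ^ℚ n ≡ sgn n /1
-1^n≡sgn zero    = refl
-1^n≡sgn (suc n) = begin
  (ℚ.- ℚ.1ℚ) ℚ.* (ℚ.- ℚ.1ℚ) ^ℚ n ≡⟨ cong ((ℚ.- ℚ.1ℚ) ℚ.*_) (-1^n≡sgn n) ⟩
  ℤ.-1ℤ /1 ℚ.* sgn n /1           ≡⟨ /1-homo-* ℤ.-1ℤ (sgn n) ⟨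
  (ℤ.-1ℤ * sgn n) /1              ≡⟨ cong _/1 (ℤP.-1*i≡-i (sgn n)) ⟩
  sgn (suc n) /1                  ∎
  where open ≡-Reasoning

Σℚ-cong : ∀ n {f g : ℕ → ℚ} → (∀ {k} → k < n → f k ≡ g k) → Σℚ n f ≡ Σℚ n g
Σℚ-cong zero    f≡g = refl
Σℚ-cong (suc n) f≡g = cong₂ ℚ._+_ (Σℚ-cong n (λ k<n → f≡g (ℕP.m<n⇒m<1+n k<n))) (f≡g ℕP.≤-refl)

*-distribˡ-Σℚ : ∀ n a (f : ℕ → ℚ) → Σℚ n (λ k → a ℚ.* f k) ≡ a ℚ.* Σℚ n f
*-distribˡ-Σℚ zero    a f = sym (ℚP.*-zeroʳ a)
*-distribˡ-Σℚ (suc n) a f =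
  trans (cong (ℚ._+ a ℚ.* f n) (*-distribˡ-Σℚ n a f)) (sym (ℚP.*-distribˡ-+ a (Σℚ n f) (f n)))

*ₛ-geom-suc : ∀ r (f : FPS) n → (f *ₛ geom r) (suc n) ≡ (+ r) /1 ℚ.* (f *ₛ geom r) n ℚ.+ f (suc n)
*ₛ-geom-suc r f n = cong₂ ℚ._+_ (trans (Σℚ-cong (suc n) shift) (*-distribˡ-Σℚ (suc n) ρ _)) last
  where
  ρ : ℚ
  ρ = (+ r) /1
  shift : ∀ {k} → k < suc n → f k ℚ.* geom r (suc n ∸ k) ≡ ρ ℚ.* (f k ℚ.* geom r (n ∸ k))
  shift {k} (s≤s k≤n) = trans (cong (λ e → f k ℚ.* geom r e) (ℕP.+-∸-assoc 1 k≤n)) (x∙yz≈y∙xz (f k) ρ _)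
  last : f (suc n) ℚ.* geom r (n ∸ n) ≡ f (suc n)
  last = trans (cong (λ e → f (suc n) ℚ.* geom r e) (ℕP.n∸n≡0 n)) (ℚP.*-identityʳ (f (suc n)))

-- At n = 0 the first summand vanishes, so this also says d 0 = 1.
DerangementRecurrence : ℕ → (ℕ → ℤ) → Set
DerangementRecurrence r d = ∀ n → d n ≡ + r * (+ n * d (ℕ.pred n)) + sgn n

module _ {r : ℕ} {d : ℕ → ℤ} (egf : HasEGF r d) where

  private
    c : FPS
    c = expNeg *ₛ geom r

    d/1≡n!*c : ∀ n → d n /1 ≡ (+ (n !)) /1 ℚ.* c n
    d/1≡n!*c n = begin
      d n /1                                 ≡⟨ ℚP.*-identityʳ (d n /1) ⟨
      d n /1 ℚ.* ℚ.1ℚ                        ≡⟨ cong (d n /1 ℚ.*_) (/1-*-inverse (n !) {{n !≢0}}) ⟨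
      d n /1 ℚ.* ((+ (n !)) /1 ℚ.* inv! n)   ≡⟨ x∙yz≈y∙xz (d n /1) ((+ (n !)) /1) (inv! n) ⟩
      (+ (n !)) /1 ℚ.* (d n /1 ℚ.* inv! n)   ≡⟨ cong ((+ (n !)) /1 ℚ.*_) (egf n) ⟩
      (+ (n !)) /1 ℚ.* c n                   ∎
      where open ≡-Reasoning

  HasEGF⇒recurrence : DerangementRecurrence r d
  HasEGF⇒recurrence zero = begin
    d 0                       ≡⟨ /1-injective (trans (sym (ℚP.*-identityʳ (d 0 /1))) (egf 0)) ⟩
    + 1                       ≡⟨ cong (_+ + 1) (ℤP.*-zeroʳ (+ r)) ⟨
    + r * (+ 0 * d 0) + + 1   ∎
    where open ≡-Reasoning
  HasEGF⇒recurrence (suc n) = /1-injective (begin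
    d (suc n) /1                                      ≡⟨ d/1≡n!*c (suc n) ⟩
    (+ (suc n !)) /1 ℚ.* c (suc n)                    ≡⟨ cong₂ ℚ._*_ [n+1]! c[n+1] ⟩
    (N ℚ.* F) ℚ.* (ρ ℚ.* c n ℚ.+ S ℚ.* inv! (suc n))  ≡⟨ expand N F ρ (c n) S (inv! (suc n)) ⟩
    ρ ℚ.* (N ℚ.* (F ℚ.* c n)) ℚ.+ S ℚ.* ((N ℚ.* F) ℚ.* inv! (suc n))
      ≡⟨ cong₂ (λ x y → ρ ℚ.* (N ℚ.* x) ℚ.+ S ℚ.* y) (sym (d/1≡n!*c n)) [n+1]!*inv! ⟩
    ρ ℚ.* (N ℚ.* d n /1) ℚ.+ S ℚ.* ℚ.1ℚ               ≡⟨ cong (ρ ℚ.* (N ℚ.* d n /1) ℚ.+_) (ℚP.*-identityʳ S) ⟩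
    ρ ℚ.* (N ℚ.* d n /1) ℚ.+ S                        ≡⟨ cong (ℚ._+ S) r*[n+1]*dₙ ⟨
    (+ r * (+ suc n * d n)) /1 ℚ.+ S                  ≡⟨ /1-homo-+ (+ r * (+ suc n * d n)) (sgn (suc n)) ⟨
    (+ r * (+ suc n * d n) + sgn (suc n)) /1          ∎)
    where
    open ≡-Reasoning
    open +-*-Solver
    N F ρ S : ℚ
    N = (+ suc n) /1
    F = (+ (n !)) /1
    ρ = (+ r) /1
    S = sgn (suc n) /1
    c[n+1] : c (suc n) ≡ ρ ℚ.* c n ℚ.+ S ℚ.* inv! (suc n)
    c[n+1] = trans (*ₛ-geom-suc r expNeg n) (cong (λ s → ρ ℚ.* c n ℚ.+ s ℚ.* inv! (suc n)) (-1^n≡sgn (suc n)))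
    [n+1]! : (+ (suc n !)) /1 ≡ N ℚ.* F
    [n+1]! = trans (cong _/1 (ℤP.pos-* (suc n) (n !))) (/1-homo-* (+ suc n) (+ (n !)))
    [n+1]!*inv! : (N ℚ.* F) ℚ.* inv! (suc n) ≡ ℚ.1ℚ
    [n+1]!*inv! = trans (cong (ℚ._* inv! (suc n)) (sym [n+1]!)) (/1-*-inverse (suc n !) {{suc n !≢0}})
    r*[n+1]*dₙ : (+ r * (+ suc n * d n)) /1 ≡ ρ ℚ.* (N ℚ.* d n /1)
    r*[n+1]*dₙ = trans (/1-homo-* (+ r) (+ suc n * d n)) (cong (ρ ℚ.*_) (/1-homo-* (+ suc n) (d n)))
    expand : ∀ a b x y s i →
             (a ℚ.* b) ℚ.* (x ℚ.* y ℚ.+ s ℚ.* i) ≡ x ℚ.* (a ℚ.* (b ℚ.* y)) ℚ.+ s ℚ.* ((a ℚ.* b) ℚ.* i)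
    expand = solve 6 (λ a b x y s i →
      (a :* b) :* (x :* y :+ s :* i) := x :* (a :* (b :* y)) :+ s :* ((a :* b) :* i)) refl

-- Finite sums

module _ {c ℓ} (M : Monoid c ℓ) where
  open Monoid M using (Carrier; _≈_; _∙_)
  private module Σ = MonoidSum M

  sum-toℕ-last : ∀ n (f : ℕ → Carrier) →
                 Σ.sum {suc n} (λ i → f (toℕ i)) ≈ Σ.sum {n} (λ i → f (toℕ i)) ∙ f n
  sum-toℕ-last n f = Monoid.trans M (Σ.sum-init-last {n} (λ i → f (toℕ i))) (Monoid.reflexive M
    (cong₂ _∙_ (Σ.sum-cong-≗ {n} (λ i → cong f (FinP.toℕ-inject₁ i))) (cong f (FinP.toℕ-fromℕ n))))

ΣFin≡sum : ∀ n (f : Vector ℤ n) → ΣFin n f ≡ sum f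
ΣFin≡sum zero    f = refl
ΣFin≡sum (suc n) f = cong (λ x → f zero + x) (ΣFin≡sum n (λ i → f (suc i)))

∑-zero : ∀ {n} {f : Vector ℤ n} → (∀ i → f i ≡ 0ℤ) → sum f ≡ 0ℤ
∑-zero {n} f≗0 = trans (sum-cong-≗ f≗0) (sum-replicate-zero n)

∑-neg : ∀ {n} (f : Vector ℤ n) → ∑[ i < n ] (- f i) ≡ - sum f
∑-neg f = begin
  ∑[ i < _ ] (- f i)       ≡⟨ sum-cong-≗ (λ i → ℤP.-1*i≡-i (f i)) ⟨
  ∑[ i < _ ] (ℤ.-1ℤ * f i) ≡⟨ *-distribˡ-sum ℤ.-1ℤ f ⟨
  ℤ.-1ℤ * sum f            ≡⟨ ℤP.-1*i≡-i (sum f) ⟩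
  - sum f                  ∎
  where open ≡-Reasoning

-- Determinants

Matrix : ℕ → Set
Matrix n = Fin n → Fin n → ℤ

minor : ∀ {n} → Matrix (suc n) → Fin (suc n) → Matrix n
minor M j a b = M (suc a) (punchIn j b)

det-expand : ∀ n (M : Matrix (suc n)) →
             det (suc n) M ≡ ∑[ j < suc n ] (sgn (toℕ' j) * (M zero j * det n (minor M j)))
det-expand n M = ΣFin≡sum (suc n) (λ j → sgn (toℕ' j) * (M zero j * det n (minor M j)))

det-cong-minors : ∀ n {A B : Matrix (suc n)} → A zero ≗ B zero →
                  (∀ j → det n (minor A j) ≡ det n (minor B j)) → det (suc n) A ≡ det (suc n) B
det-cong-minors n {A} {B} row₀ minors = begin
  det (suc n) A                                                   ≡⟨ det-expand n A ⟩
  ∑[ j < suc n ] (sgn (toℕ' j) * (A zero j * det n (minor A j)))  ≡⟨ sum-cong-≗ term ⟩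
  ∑[ j < suc n ] (sgn (toℕ' j) * (B zero j * det n (minor B j)))  ≡⟨ det-expand n B ⟨
  det (suc n) B                                                   ∎
  where
  open ≡-Reasoning
  term : ∀ j → sgn (toℕ' j) * (A zero j * det n (minor A j)) ≡ sgn (toℕ' j) * (B zero j * det n (minor B j))
  term j = cong₂ (λ x y → sgn (toℕ' j) * (x * y)) (row₀ j) (minors j)

det-cong : ∀ n {A B : Matrix n} → (∀ a b → A a b ≡ B a b) → det n A ≡ det n B
det-cong zero    A≡B = refl
det-cong (suc n) {A} {B} A≡B =
  det-cong-minors n {A} {B} (A≡B zero) (λ j → det-cong n (λ a b → A≡B (suc a) (punchIn j b)))

det-linear-row₀ : ∀ n (u w : Vector ℤ (suc n)) c (R : Vector (Vector ℤ (suc n)) n) →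
  det (suc n) ((λ b → u b + c * w b) ∷ R) ≡ det (suc n) (u ∷ R) + c * det (suc n) (w ∷ R)
det-linear-row₀ n u w c R = begin
  det (suc n) ((λ b → u b + c * w b) ∷ R)
    ≡⟨ det-expand n ((λ b → u b + c * w b) ∷ R) ⟩
  ∑[ j < suc n ] (s j * ((u j + c * w j) * D j))
    ≡⟨ sum-cong-≗ (λ j → distrib (s j) (u j) c (w j) (D j)) ⟩
  ∑[ j < suc n ] (s j * (u j * D j) + c * (s j * (w j * D j)))
    ≡⟨ ∑-distrib-+ (λ j → s j * (u j * D j)) (λ j → c * (s j * (w j * D j))) ⟩
  ∑[ j < suc n ] (s j * (u j * D j)) + ∑[ j < suc n ] (c * (s j * (w j * D j)))
    ≡⟨ cong₂ _+_ (det-expand n (u ∷ R)) (*-distribˡ-sum c (λ j → s j * (w j * D j))) ⟨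
  det (suc n) (u ∷ R) + c * ∑[ j < suc n ] (s j * (w j * D j))
    ≡⟨ cong (λ x → det (suc n) (u ∷ R) + c * x) (det-expand n (w ∷ R)) ⟨
  det (suc n) (u ∷ R) + c * det (suc n) (w ∷ R)
    ∎
  where
  open ≡-Reasoning
  s D : Fin (suc n) → ℤ
  s j = sgn (toℕ' j)
  D j = det n (minor (u ∷ R) j)
  distrib : ∀ s u c w x → s * ((u + c * w) * x) ≡ s * (u * x) + c * (s * (w * x))
  distrib = solve-∀

twoRowExpansion : ∀ m → (v w : Vector ℤ (suc (suc m))) → ((Fin m → Fin (suc (suc m))) → ℤ) → ℤ
twoRowExpansion m v w F =
  ∑[ j < suc (suc m) ] (sgn (toℕ' j) * (v j *
    ∑[ k < suc m ] (sgn (toℕ' k) * (w (punchIn j k) * F (λ b → punchIn j (punchIn k b))))))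

det-twoRowExpansion : ∀ m v w (R : Vector (Vector ℤ (suc (suc m))) m) →
  det (suc (suc m)) (v ∷ w ∷ R) ≡ twoRowExpansion m v w (λ σ → det m (λ a b → R a (σ b)))
det-twoRowExpansion m v w R = trans (det-expand (suc m) (v ∷ w ∷ R))
  (sum-cong-≗ (λ j → cong (λ x → sgn (toℕ' j) * (v j * x)) (det-expand m (minor (v ∷ w ∷ R) j))))

crossTerm : ∀ m → (v w : Vector ℤ (suc (suc m))) → ((Fin m → Fin (suc (suc m))) → ℤ) → ℤ
crossTerm m v w F = v zero * ∑[ k < suc m ] (sgn (toℕ' k) * (w (suc k) * F (λ b → suc (punchIn k b))))

innerTerms : ∀ m → (v w : Vector ℤ (suc (suc m))) → ((Fin m → Fin (suc (suc m))) → ℤ) → ℤ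
innerTerms m v w F =
  ∑[ j < suc m ] (sgn (toℕ' j) * (v (suc j) *
    ∑[ k < m ] (sgn (toℕ' k) * (w (suc (punchIn j k)) * F (λ b → punchIn (suc j) (punchIn (suc k) b))))))

twoRowExpansion-split : ∀ m v w F →
  twoRowExpansion m v w F ≡ crossTerm m v w F - crossTerm m w v F + innerTerms m v w F
twoRowExpansion-split m v w F = begin
  twoRowExpansion m v w F
    ≡⟨ cong₂ _+_ (ℤP.*-identityˡ (crossTerm m v w F)) (sum-cong-≗ term) ⟩
  crossTerm m v w F + ∑[ j < suc m ] (- A j + B j)
    ≡⟨ cong (λ x → crossTerm m v w F + x) (∑-distrib-+ (λ j → - A j) B) ⟩
  crossTerm m v w F + (∑[ j < suc m ] (- A j) + innerTerms m v w F)
    ≡⟨ cong (λ x → crossTerm m v w F + (x + innerTerms m v w F)) ∑A ⟩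
  crossTerm m v w F + (- crossTerm m w v F + innerTerms m v w F)
    ≡⟨ ℤP.+-assoc (crossTerm m v w F) (- crossTerm m w v F) (innerTerms m v w F) ⟨
  crossTerm m v w F - crossTerm m w v F + innerTerms m v w F
    ∎
  where
  open ≡-Reasoning
  s : ∀ {n} → Fin n → ℤ
  s k = sgn (toℕ' k)
  G : Fin (suc m) → ℤ
  G j = F (λ b → suc (punchIn j b))
  W : Fin (suc m) → Fin m → ℤ
  W j k = w (suc (punchIn j k)) * F (λ b → punchIn (suc j) (punchIn (suc k) b))
  A B : Fin (suc m) → ℤ
  A j = w zero * (s j * (v (suc j) * G j))
  B j = s j * (v (suc j) * ∑[ k < m ] (s k * W j k))
  ∑A : ∑[ j < suc m ] (- A j) ≡ - crossTerm m w v F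
  ∑A = trans (∑-neg A) (cong -_ (sym (*-distribˡ-sum (w zero) (λ j → s j * (v (suc j) * G j)))))
  rearrange : ∀ s v w g S → - s * (v * (1ℤ * (w * g) + - S)) ≡ - (w * (s * (v * g))) + s * (v * S)
  rearrange = solve-∀
  term : ∀ j → - s j * (v (suc j) * (1ℤ * (w zero * G j) + ∑[ k < m ] (- s k * W j k))) ≡ - A j + B j
  term j = trans (cong (λ x → - s j * (v (suc j) * (1ℤ * (w zero * G j) + x)))
                       (trans (sum-cong-≗ (λ k → sym (ℤP.neg-distribˡ-* (s k) (W j k)))) (∑-neg (λ k → s k * W j k))))
                 (rearrange (s j) (v (suc j)) (w zero) (G j) (∑[ k < m ] (s k * W j k)))

innerTerms-zero : ∀ v w F → innerTerms zero v w F ≡ 0ℤ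
innerTerms-zero v w F = cong (λ x → 1ℤ * x + 0ℤ) (ℤP.*-zeroʳ (v (suc zero)))

innerTerms-suc : ∀ m v w {F} → F Preserves _≗_ ⟶ _≡_ →
  innerTerms (suc m) v w F ≡ twoRowExpansion m (v ∘′ suc) (w ∘′ suc) (λ σ → F (lift 1 σ))
innerTerms-suc m v w {F} F-cong =
  sum-cong-≗ λ j → cong (λ x → sgn (toℕ' j) * (v (suc j) * x)) (sum-cong-≗ λ k →
    cong (λ x → sgn (toℕ' k) * (w (suc (punchIn j k)) * x))
         (F-cong {λ b → punchIn (suc j) (punchIn (suc k) b)} {lift 1 (λ b → punchIn j (punchIn k b))}
                 λ { zero → refl ; (suc b) → refl }))

-- Induction on m: the terms in which one of the two rows meets column 0 are antisymmetric
-- by themselves, and the remaining ones form a two-row expansion of size m - 1.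
twoRowExpansion-antisym : ∀ m v w {F} → F Preserves _≗_ ⟶ _≡_ →
  twoRowExpansion m v w F ≡ - twoRowExpansion m w v F
twoRowExpansion-antisym m v w {F} F-cong = begin
  twoRowExpansion m v w F                                          ≡⟨ twoRowExpansion-split m v w F ⟩
  crossTerm m v w F - crossTerm m w v F + innerTerms m v w F       ≡⟨ cong (λ x → X - Y + x) (inner-antisym m v w F-cong) ⟩
  crossTerm m v w F - crossTerm m w v F - innerTerms m w v F       ≡⟨ swap X Y (innerTerms m w v F) ⟩
  - (crossTerm m w v F - crossTerm m v w F + innerTerms m w v F)   ≡⟨ cong -_ (twoRowExpansion-split m w v F) ⟨
  - twoRowExpansion m w v F                                        ∎
  where
  open ≡-Reasoning
  X Y : ℤ
  X = crossTerm m v w F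
  Y = crossTerm m w v F
  swap : ∀ x y z → x - y - z ≡ - (y - x + z)
  swap = solve-∀
  inner-antisym : ∀ m v w {F} → F Preserves _≗_ ⟶ _≡_ → innerTerms m v w F ≡ - innerTerms m w v F
  inner-antisym zero    v w {F} _      = trans (innerTerms-zero v w F) (cong -_ (sym (innerTerms-zero w v F)))
  inner-antisym (suc m) v w {F} F-cong = begin
    innerTerms (suc m) v w F                      ≡⟨ innerTerms-suc m v w F-cong ⟩
    twoRowExpansion m (v ∘′ suc) (w ∘′ suc) F↑    ≡⟨ twoRowExpansion-antisym m (v ∘′ suc) (w ∘′ suc) F↑-cong ⟩
    - twoRowExpansion m (w ∘′ suc) (v ∘′ suc) F↑  ≡⟨ cong -_ (innerTerms-suc m w v F-cong) ⟨
    - innerTerms (suc m) w v F                    ∎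
    where
    F↑ : (Fin m → Fin (suc (suc m))) → ℤ
    F↑ σ = F (lift 1 σ)
    F↑-cong : F↑ Preserves _≗_ ⟶ _≡_
    F↑-cong σ≗τ = F-cong λ { zero → refl ; (suc b) → cong suc (σ≗τ b) }

det-swap₀₁ : ∀ m v w (R : Vector (Vector ℤ (suc (suc m))) m) →
             det (suc (suc m)) (v ∷ w ∷ R) ≡ - det (suc (suc m)) (w ∷ v ∷ R)
det-swap₀₁ m v w R = begin
  det (suc (suc m)) (v ∷ w ∷ R)    ≡⟨ det-twoRowExpansion m v w R ⟩
  twoRowExpansion m v w F          ≡⟨ twoRowExpansion-antisym m v w F-cong ⟩
  - twoRowExpansion m w v F        ≡⟨ cong -_ (det-twoRowExpansion m w v R) ⟨
  - det (suc (suc m)) (w ∷ v ∷ R)  ∎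
  where
  open ≡-Reasoning
  F : (Fin m → Fin (suc (suc m))) → ℤ
  F σ = det m (λ a b → R a (σ b))
  F-cong : F Preserves _≗_ ⟶ _≡_
  F-cong {σ} {τ} σ≗τ = det-cong m {λ a b → R a (σ b)} {λ a b → R a (τ b)} (λ a b → cong (R a) (σ≗τ b))

i≡-i⇒i≡0 : ∀ {i} → i ≡ - i → i ≡ 0ℤ
i≡-i⇒i≡0 {+ zero}     _  = refl
i≡-i⇒i≡0 {ℤ.+[1+ n ]} ()
i≡-i⇒i≡0 {ℤ.-[1+ n ]} ()

det-equalRows₀₁ : ∀ m v (R : Vector (Vector ℤ (suc (suc m))) m) → det (suc (suc m)) (v ∷ v ∷ R) ≡ 0ℤ
det-equalRows₀₁ m v R = i≡-i⇒i≡0 (det-swap₀₁ m v v R)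

det-∷-η : ∀ n v (R : Vector (Vector ℤ (suc (suc n))) (suc n)) →
          det (suc (suc n)) (v ∷ R) ≡ det (suc (suc n)) (v ∷ R zero ∷ R ∘′ suc)
det-∷-η n v R = det-cong (suc (suc n)) {v ∷ R} {v ∷ R zero ∷ R ∘′ suc} rows
  where
  rows : ∀ a b → (v ∷ R) a b ≡ (v ∷ R zero ∷ R ∘′ suc) a b
  rows zero          b = refl
  rows (suc zero)    b = refl
  rows (suc (suc a)) b = refl

det-minor-∷ : ∀ n u v (R : Vector (Vector ℤ (suc (suc n))) n) j →
              det (suc n) (minor (u ∷ v ∷ R) j) ≡ det (suc n) (v ∘′ punchIn j ∷ λ a b → R a (punchIn j b))
det-minor-∷ n u v R j = det-cong (suc n) {minor (u ∷ v ∷ R) j} {v ∘′ punchIn j ∷ λ a b → R a (punchIn j b)}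
                                 (λ { zero b → refl ; (suc a) b → refl })

-- After swapping rows 0 and 1, the multiples of v added to rows 2, 3, … become multiples of
-- the first row of every minor, so induction applies; row 1 is handled by linearity.
det-addMultiplesOfRow₀ : ∀ n (v : Vector ℤ (suc n)) (R : Vector (Vector ℤ (suc n)) n) (c : Vector ℤ n) →
                         det (suc n) (v ∷ (λ a b → R a b + c a * v b)) ≡ det (suc n) (v ∷ R)
det-addMultiplesOfRow₀ zero    v R c = refl
det-addMultiplesOfRow₀ (suc n) v R c = begin
  D (v ∷ R⁺)                                    ≡⟨ det-∷-η n v R⁺ ⟩
  D (v ∷ R⁺ zero ∷ rest⁺)                       ≡⟨ det-swap₀₁ n v (R⁺ zero) rest⁺ ⟩
  - D (R⁺ zero ∷ v ∷ rest⁺)                     ≡⟨ cong -_ (det-linear-row₀ (suc n) (R zero) v (c zero) (v ∷ rest⁺)) ⟩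
  - (D (R zero ∷ v ∷ rest⁺) + c zero * D (v ∷ v ∷ rest⁺))
    ≡⟨ cong (λ x → - (D (R zero ∷ v ∷ rest⁺) + c zero * x)) (det-equalRows₀₁ n v rest⁺) ⟩
  - (D (R zero ∷ v ∷ rest⁺) + c zero * 0ℤ)      ≡⟨ cong -_ (x+c*0≡x (D (R zero ∷ v ∷ rest⁺)) (c zero)) ⟩
  - D (R zero ∷ v ∷ rest⁺)
    ≡⟨ cong -_ (det-cong-minors (suc n) {R zero ∷ v ∷ rest⁺} {R zero ∷ v ∷ rest} (λ _ → refl) minors) ⟩
  - D (R zero ∷ v ∷ rest)                       ≡⟨ det-swap₀₁ n v (R zero) rest ⟨
  D (v ∷ R zero ∷ rest)                         ≡⟨ det-∷-η n v R ⟨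
  D (v ∷ R)                                     ∎
  where
  open ≡-Reasoning
  D : Matrix (suc (suc n)) → ℤ
  D = det (suc (suc n))
  R⁺ : Vector (Vector ℤ (suc (suc n))) (suc n)
  R⁺ a b = R a b + c a * v b
  rest rest⁺ : Vector (Vector ℤ (suc (suc n))) n
  rest  = R ∘′ suc
  rest⁺ = R⁺ ∘′ suc
  x+c*0≡x : ∀ x c → x + c * 0ℤ ≡ x
  x+c*0≡x x c = trans (cong (λ y → x + y) (ℤP.*-zeroʳ c)) (ℤP.+-identityʳ x)
  minors : ∀ j → det (suc n) (minor (R zero ∷ v ∷ rest⁺) j) ≡ det (suc n) (minor (R zero ∷ v ∷ rest) j)
  minors j = begin
    det (suc n) (minor (R zero ∷ v ∷ rest⁺) j)  ≡⟨ det-minor-∷ n (R zero) v rest⁺ j ⟩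
    det (suc n) (v ∘′ punchIn j ∷ λ a b → R (suc a) (punchIn j b) + c (suc a) * v (punchIn j b))
      ≡⟨ det-addMultiplesOfRow₀ n (v ∘′ punchIn j) (λ a b → R (suc a) (punchIn j b)) (c ∘′ suc) ⟩
    det (suc n) (v ∘′ punchIn j ∷ λ a b → R (suc a) (punchIn j b))
      ≡⟨ det-minor-∷ n (R zero) v rest j ⟨
    det (suc n) (minor (R zero ∷ v ∷ rest) j)   ∎

_·_ : ∀ {l m n} → (Fin l → Fin m → ℤ) → (Fin m → Fin n → ℤ) → Fin l → Fin n → ℤ
_·_ {m = m} P H a b = ∑[ k < m ] (P a k * H k b)

UnitLowerTriangular : ∀ {n} → Matrix n → Set
UnitLowerTriangular P = (∀ a → P a a ≡ 1ℤ) × (∀ {a b} → a Fin.< b → P a b ≡ 0ℤ)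

UpperTriangular : ∀ {n} → Matrix n → Set
UpperTriangular M = ∀ {a b} → b Fin.< a → M a b ≡ 0ℤ

det-unitLowerTriangular-· : ∀ n {P : Matrix n} → UnitLowerTriangular P → (H : Matrix n) → det n (P · H) ≡ det n H
det-unitLowerTriangular-· zero    _                  H = refl
det-unitLowerTriangular-· (suc n) {P} (diag , upper) H = begin
  det (suc n) (P · H)                                ≡⟨ det-cong (suc n) {P · H} {H zero ∷ P′·H′+c*H₀} rows ⟩
  det (suc n) (H zero ∷ P′·H′+c*H₀)                  ≡⟨ det-addMultiplesOfRow₀ n (H zero) (P′ · H′) c ⟩
  det (suc n) (H zero ∷ P′ · H′)                     ≡⟨ det-cong-minors n {H zero ∷ P′ · H′} {H} (λ _ → refl) minors ⟩
  det (suc n) H                                      ∎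
  where
  open ≡-Reasoning
  P′ : Matrix n
  P′ a b = P (suc a) (suc b)
  H′ : Vector (Vector ℤ (suc n)) n
  H′ = H ∘′ suc
  c : Vector ℤ n
  c a = P (suc a) zero
  P′·H′+c*H₀ : Vector (Vector ℤ (suc n)) n
  P′·H′+c*H₀ a b = (P′ · H′) a b + c a * H zero b
  rows : ∀ a b → (P · H) a b ≡ (H zero ∷ P′·H′+c*H₀) a b
  rows zero    b = begin
    P zero zero * H zero b + ∑[ k < n ] (P zero (suc k) * H (suc k) b)
      ≡⟨ cong₂ _+_ (cong (_* H zero b) (diag zero)) (∑-zero λ k → cong (_* H (suc k) b) (upper (s≤s z≤n))) ⟩
    1ℤ * H zero b + 0ℤ
      ≡⟨ trans (ℤP.+-identityʳ (1ℤ * H zero b)) (ℤP.*-identityˡ (H zero b)) ⟩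
    H zero b
      ∎
  rows (suc a) b = ℤP.+-comm (c a * H zero b) ((P′ · H′) a b)
  minors : ∀ j → det n (minor (H zero ∷ P′ · H′) j) ≡ det n (minor H j)
  minors j = det-unitLowerTriangular-· n ((λ a → diag (suc a)) , λ a<b → upper (s≤s a<b)) (minor H j)

det-firstColumn : ∀ n (M : Matrix (suc n)) → (∀ a → M (suc a) zero ≡ 0ℤ) →
                  det (suc n) M ≡ M zero zero * det n (minor M zero)
det-firstColumn zero    M _    = trans (ℤP.+-identityʳ _) (ℤP.*-identityˡ _)
det-firstColumn (suc n) M col₀ = begin
  det (suc (suc n)) M
    ≡⟨ det-expand (suc n) M ⟩
  1ℤ * (M zero zero * det (suc n) (minor M zero)) + ∑[ j < suc n ] offDiagonalTerm j
    ≡⟨ cong₂ _+_ (ℤP.*-identityˡ (M zero zero * det (suc n) (minor M zero))) (∑-zero offDiagonal) ⟩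
  M zero zero * det (suc n) (minor M zero) + 0ℤ
    ≡⟨ ℤP.+-identityʳ _ ⟩
  M zero zero * det (suc n) (minor M zero)
    ∎
  where
  open ≡-Reasoning
  minor-vanishes : ∀ j → det (suc n) (minor M (suc j)) ≡ 0ℤ
  minor-vanishes j = trans (det-firstColumn n (minor M (suc j)) (λ a → col₀ (suc a)))
                           (cong (_* det n (minor (minor M (suc j)) zero)) (col₀ zero))
  offDiagonalTerm : Fin (suc n) → ℤ
  offDiagonalTerm j = - sgn (toℕ' j) * (M zero (suc j) * det (suc n) (minor M (suc j)))
  offDiagonal : ∀ j → offDiagonalTerm j ≡ 0ℤ
  offDiagonal j = trans (cong (λ x → - sgn (toℕ' j) * (M zero (suc j) * x)) (minor-vanishes j))
                        (trans (cong (- sgn (toℕ' j) *_) (ℤP.*-zeroʳ (M zero (suc j)))) (ℤP.*-zeroʳ (- sgn (toℕ' j))))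

det-upperTriangular : ∀ n (M : Matrix n) → UpperTriangular M → det n M ≡ product (λ a → M a a)
det-upperTriangular zero    M _     = refl
det-upperTriangular (suc n) M upper =
  trans (det-firstColumn n M (λ _ → upper (s≤s z≤n)))
        (cong (M zero zero *_) (det-upperTriangular n (minor M zero) (λ b<a → upper (s≤s b<a))))

-- Polynomials

Poly : Set
Poly = ℕ → ℤ

∂ : Poly → Poly
∂ h m = + suc m * h (suc m)

mul1+y : Poly → Poly
mul1+y h zero    = h zero
mul1+y h (suc m) = h (suc m) + h m

binomial : ℕ → Poly
binomial zero    zero    = 1ℤ
binomial zero    (suc m) = 0ℤ
binomial (suc k)         = mul1+y (binomial k)

Degree< : ℕ → Poly → Set
Degree< K h = ∀ {m} → K ≤ m → h m ≡ 0ℤ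

Degree<-weaken : ∀ {k K h} → k ≤ K → Degree< k h → Degree< K h
Degree<-weaken k≤K deg K≤m = deg (ℕP.≤-trans k≤K K≤m)

binomial-degree : ∀ k → Degree< (suc k) (binomial k)
binomial-degree zero    {suc m}       _         = refl
binomial-degree (suc k) {suc (suc m)} (s≤s k<m) =
  cong₂ _+_ (binomial-degree k (ℕP.m≤n⇒m≤1+n k<m)) (binomial-degree k k<m)

binomial-top : ∀ k → binomial k k ≡ 1ℤ
binomial-top zero    = refl
binomial-top (suc k) = cong₂ _+_ (binomial-degree k ℕP.≤-refl) (binomial-top k)

mul1+y-cong : ∀ {f g} → f ≗ g → mul1+y f ≗ mul1+y g
mul1+y-cong f≗g zero    = f≗g zero
mul1+y-cong f≗g (suc m) = cong₂ _+_ (f≗g (suc m)) (f≗g m)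

mul1+y-scale : ∀ c f → mul1+y (λ m → c * f m) ≗ λ m → c * mul1+y f m
mul1+y-scale c f zero    = refl
mul1+y-scale c f (suc m) = sym (ℤP.*-distribˡ-+ c (f (suc m)) (f m))

mul1+y-linear : ∀ f g c → mul1+y (λ m → f m - c * g m) ≗ λ m → mul1+y f m - c * mul1+y g m
mul1+y-linear f g c zero    = refl
mul1+y-linear f g c (suc m) = rearrange (f (suc m)) (f m) c (g (suc m)) (g m)
  where
  rearrange : ∀ f₁ f₀ c g₁ g₀ → (f₁ - c * g₁) + (f₀ - c * g₀) ≡ (f₁ + f₀) - c * (g₁ + g₀)
  rearrange = solve-∀

∂-mul1+y : ∀ g → ∂ (mul1+y g) ≗ λ m → g m + mul1+y (∂ g) m
∂-mul1+y g zero    = leibniz₀ (g 1) (g 0)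
  where
  leibniz₀ : ∀ g₁ g₀ → + 1 * (g₁ + g₀) ≡ g₀ + + 1 * g₁
  leibniz₀ = solve-∀
∂-mul1+y g (suc m) = trans (cong (_* (g (suc (suc m)) + g (suc m))) (ℤP.pos-+ 1 (suc m)))
                           (leibniz (+ suc m) (g (suc (suc m))) (g (suc m)))
  where
  leibniz : ∀ n g₂ g₁ → (+ 1 + n) * (g₂ + g₁) ≡ g₁ + ((+ 1 + n) * g₂ + n * g₁)
  leibniz = solve-∀

∂-binomial : ∀ k → ∂ (binomial (suc k)) ≗ λ m → + suc k * binomial k m
∂-binomial zero    zero    = refl
∂-binomial zero    (suc m) = ℤP.*-zeroʳ (+ suc (suc m))
∂-binomial (suc k) m = begin
  ∂ (mul1+y (binomial (suc k))) m                               ≡⟨ ∂-mul1+y (binomial (suc k)) m ⟩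
  bₘ + mul1+y (∂ (binomial (suc k))) m                          ≡⟨ cong (λ x → bₘ + x) (mul1+y-cong (∂-binomial k) m) ⟩
  bₘ + mul1+y (λ m → + suc k * binomial k m) m                  ≡⟨ cong (λ x → bₘ + x) (mul1+y-scale (+ suc k) (binomial k) m) ⟩
  bₘ + + suc k * bₘ                                             ≡⟨ collect (+ suc k) bₘ ⟩
  (+ 1 + + suc k) * bₘ                                          ≡⟨ cong (_* bₘ) (ℤP.pos-+ 1 (suc k)) ⟨
  + suc (suc k) * bₘ                                            ∎
  where
  open ≡-Reasoning
  bₘ : ℤ
  bₘ = binomial (suc k) m
  collect : ∀ n x → x + n * x ≡ (+ 1 + n) * x
  collect = solve-∀

pairing : ℕ → Poly → (ℕ → ℤ) → ℤ
pairing K h w = ∑[ m < K ] (h (toℕ m) * w (toℕ m))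

at-1 : ℕ → Poly → ℤ
at-1 K h = pairing K h sgn

pairing-cong : ∀ K {f g} w → f ≗ g → pairing K f w ≡ pairing K g w
pairing-cong K w f≗g = sum-cong-≗ {K} (λ m → cong (_* w (toℕ m)) (f≗g (toℕ m)))

pairing-scale : ∀ K c f w → pairing K (λ m → c * f m) w ≡ c * pairing K f w
pairing-scale K c f w = trans (sum-cong-≗ {K} (λ m → ℤP.*-assoc c (f (toℕ m)) (w (toℕ m))))
                              (sym (*-distribˡ-sum {K} c (λ m → f (toℕ m) * w (toℕ m))))

pairing-linear : ∀ K f g c w → pairing K (λ m → f m - c * g m) w ≡ pairing K f w - c * pairing K g w
pairing-linear K f g c w = begin
  ∑[ m < K ] ((f (toℕ m) - c * g (toℕ m)) * w (toℕ m))
    ≡⟨ sum-cong-≗ {K} (λ m → distrib (f (toℕ m)) c (g (toℕ m)) (w (toℕ m))) ⟩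
  ∑[ m < K ] (f (toℕ m) * w (toℕ m) + - c * (g (toℕ m) * w (toℕ m)))
    ≡⟨ ∑-distrib-+ {K} (λ m → f (toℕ m) * w (toℕ m)) (λ m → - c * (g (toℕ m) * w (toℕ m))) ⟩
  pairing K f w + ∑[ m < K ] (- c * (g (toℕ m) * w (toℕ m)))
    ≡⟨ cong (λ x → pairing K f w + x) (*-distribˡ-sum {K} (- c) (λ m → g (toℕ m) * w (toℕ m))) ⟨
  pairing K f w + - c * pairing K g w
    ≡⟨ cong (λ x → pairing K f w + x) (ℤP.neg-distribˡ-* c (pairing K g w)) ⟨
  pairing K f w - c * pairing K g w
    ∎
  where
  open ≡-Reasoning
  distrib : ∀ f c g w → (f - c * g) * w ≡ f * w + - c * (g * w)
  distrib = solve-∀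

∑-shift : ∀ K (f : ℕ → ℤ) → f 0 ≡ 0ℤ → f K ≡ 0ℤ → ∑[ m < K ] f (toℕ m) ≡ ∑[ m < K ] f (suc (toℕ m))
∑-shift zero    f f₀ f_K = refl
∑-shift (suc K) f f₀ f_K = begin
  f 0 + S                 ≡⟨ cong (_+ S) f₀ ⟩
  0ℤ + S                  ≡⟨ ℤP.+-comm 0ℤ S ⟩
  S + 0ℤ                  ≡⟨ cong (λ x → S + x) f_K ⟨
  S + f (suc K)           ≡⟨ sum-toℕ-last ℤP.+-0-monoid K (f ∘′ suc) ⟨
  ∑[ m < suc K ] f (suc (toℕ m)) ∎
  where
  open ≡-Reasoning
  S : ℤ
  S = ∑[ m < K ] f (suc (toℕ m))

at-1-mul1+y : ∀ K g → at-1 (suc K) (mul1+y g) ≡ g K * sgn K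
at-1-mul1+y zero    g = ℤP.+-identityʳ (g 0 * 1ℤ)
at-1-mul1+y (suc K) g = begin
  at-1 (suc (suc K)) (mul1+y g)                    ≡⟨ sum-toℕ-last ℤP.+-0-monoid (suc K) (λ m → mul1+y g m * sgn m) ⟩
  at-1 (suc K) (mul1+y g) + (g (suc K) + g K) * - sgn K ≡⟨ cong (_+ (g (suc K) + g K) * - sgn K) (at-1-mul1+y K g) ⟩
  g K * sgn K + (g (suc K) + g K) * - sgn K        ≡⟨ telescope (g K) (g (suc K)) (sgn K) ⟩
  g (suc K) * - sgn K                              ∎
  where
  open ≡-Reasoning
  telescope : ∀ a b s → a * s + (b + a) * - s ≡ b * - s
  telescope = solve-∀

module _ (r : ℕ) where

  T : Poly → Poly
  T h m = h m - + r * ∂ h m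

  T^ : ℕ → Poly → Poly
  T^ i h = fold h T i

  T-cong : ∀ {f g} → f ≗ g → T f ≗ T g
  T-cong f≗g m = cong₂ (λ x y → x - + r * (+ suc m * y)) (f≗g m) (f≗g (suc m))

  T-linear : ∀ f g c → T (λ m → f m - c * g m) ≗ λ m → T f m - c * T g m
  T-linear f g c m = rearrange (f m) (f (suc m)) (g m) (g (suc m)) c (+ r) (+ suc m)
    where
    rearrange : ∀ f₀ f₁ g₀ g₁ c r n →
                f₀ - c * g₀ - r * (n * (f₁ - c * g₁)) ≡ f₀ - r * (n * f₁) - c * (g₀ - r * (n * g₁))
    rearrange = solve-∀

  T-mul1+y : ∀ g → T (mul1+y g) ≗ λ m → mul1+y (T g) m - + r * g m
  T-mul1+y g m = begin
    mul1+y g m - + r * ∂ (mul1+y g) m              ≡⟨ cong (λ x → mul1+y g m - + r * x) (∂-mul1+y g m) ⟩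
    mul1+y g m - + r * (g m + mul1+y (∂ g) m)      ≡⟨ rearrange (mul1+y g m) (+ r) (g m) (mul1+y (∂ g) m) ⟩
    mul1+y g m - + r * mul1+y (∂ g) m - + r * g m  ≡⟨ cong (_- + r * g m) (mul1+y-linear g (∂ g) (+ r) m) ⟨
    mul1+y (T g) m - + r * g m                     ∎
    where
    open ≡-Reasoning
    rearrange : ∀ x r y z → x - r * (y + z) ≡ x - r * z - r * y
    rearrange = solve-∀

  T^-mul1+y : ∀ i g → T^ (suc i) (mul1+y g) ≗ λ m → mul1+y (T^ (suc i) g) m - + suc i * + r * T^ i g m
  T^-mul1+y zero    g m = trans (T-mul1+y g m) (cong (λ x → mul1+y (T g) m - x * g m) (sym (ℤP.*-identityˡ (+ r))))
  T^-mul1+y (suc i) g m = begin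
    T (T^ (suc i) (mul1+y g)) m                                        ≡⟨ T-cong (T^-mul1+y i g) m ⟩
    T (λ m → mul1+y (T^ (suc i) g) m - c * T^ i g m) m                 ≡⟨ T-linear (mul1+y (T^ (suc i) g)) (T^ i g) c m ⟩
    T (mul1+y (T^ (suc i) g)) m - c * T^ (suc i) g m                   ≡⟨ cong (_- c * T^ (suc i) g m) (T-mul1+y (T^ (suc i) g) m) ⟩
    mul1+y (T^ (2 ℕ.+ i) g) m - + r * T^ (suc i) g m - c * T^ (suc i) g m
      ≡⟨ collect (mul1+y (T^ (2 ℕ.+ i) g) m) (+ r) (+ suc i) (T^ (suc i) g m) ⟩
    mul1+y (T^ (2 ℕ.+ i) g) m - (+ 1 + + suc i) * + r * T^ (suc i) g m
      ≡⟨ cong (λ n → mul1+y (T^ (2 ℕ.+ i) g) m - n * + r * T^ (suc i) g m) (ℤP.pos-+ 1 (suc i)) ⟨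
    mul1+y (T^ (2 ℕ.+ i) g) m - + (2 ℕ.+ i) * + r * T^ (suc i) g m
      ∎
    where
    open ≡-Reasoning
    c : ℤ
    c = + suc i * + r
    collect : ∀ x r n y → x - r * y - n * r * y ≡ x - (+ 1 + n) * r * y
    collect = solve-∀

  T-top : ∀ {k h} → h (suc k) ≡ 0ℤ → T h k ≡ h k
  T-top {k} {h} top = begin
    h k - + r * (+ suc k * h (suc k))  ≡⟨ cong (λ y → h k - + r * (+ suc k * y)) top ⟩
    h k - + r * (+ suc k * 0ℤ)         ≡⟨ vanish (h k) (+ r) (+ suc k) ⟩
    h k                                ∎
    where
    open ≡-Reasoning
    vanish : ∀ x r n → x - r * (n * 0ℤ) ≡ x
    vanish = solve-∀

  T-degree : ∀ {K h} → Degree< K h → Degree< K (T h)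
  T-degree {h = h} deg {m} K≤m = trans (T-top {m} {h} (deg (ℕP.m≤n⇒m≤1+n K≤m))) (deg K≤m)

  T^-degree : ∀ {K h} i → Degree< K h → Degree< K (T^ i h)
  T^-degree zero    deg = deg
  T^-degree (suc i) deg = T-degree (T^-degree i deg)

  T^-top : ∀ {k h} i → Degree< (suc k) h → T^ i h k ≡ h k
  T^-top         zero    deg = refl
  T^-top {k} {h} (suc i) deg = trans (T-top {k} {T^ i h} (T^-degree i deg ℕP.≤-refl)) (T^-top i deg)

  at-1-T^-binomial : ∀ {k K} i → i < k → k < K → at-1 K (T^ i (binomial k)) ≡ 0ℤ
  at-1-T^-binomial {suc k} {suc K} zero    _         (s≤s k<K) =
    trans (at-1-mul1+y K (binomial k)) (cong (_* sgn K) (binomial-degree k k<K))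
  at-1-T^-binomial {suc k} {suc K} (suc i) (s≤s i<k) (s≤s k<K) = begin
    at-1 (suc K) (T^ (suc i) (mul1+y (binomial k)))
      ≡⟨ pairing-cong (suc K) sgn (T^-mul1+y i (binomial k)) ⟩
    at-1 (suc K) (λ m → mul1+y (T^ (suc i) (binomial k)) m - c * T^ i (binomial k) m)
      ≡⟨ pairing-linear (suc K) (mul1+y (T^ (suc i) (binomial k))) (T^ i (binomial k)) c sgn ⟩
    at-1 (suc K) (mul1+y (T^ (suc i) (binomial k))) - c * at-1 (suc K) (T^ i (binomial k))
      ≡⟨ cong₂ (λ x y → x - c * y) at-1-mul1+y≡0 (at-1-T^-binomial i i<k (ℕP.<-trans (ℕP.n<1+n k) (s≤s k<K))) ⟩
    0ℤ - c * 0ℤ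
      ≡⟨ cong (λ x → 0ℤ - x) (ℤP.*-zeroʳ c) ⟩
    0ℤ
      ∎
    where
    open ≡-Reasoning
    c : ℤ
    c = + suc i * + r
    at-1-mul1+y≡0 : at-1 (suc K) (mul1+y (T^ (suc i) (binomial k))) ≡ 0ℤ
    at-1-mul1+y≡0 = trans (at-1-mul1+y K (T^ (suc i) (binomial k)))
                          (cong (_* sgn K) (T^-degree (suc i) (binomial-degree k) k<K))

-- The moment functional

sgn-+ : ∀ m j → sgn (m ℕ.+ j) ≡ sgn m * sgn j
sgn-+ zero    j = sym (ℤP.*-identityˡ (sgn j))
sgn-+ (suc m) j = trans (cong -_ (sgn-+ m j)) (ℤP.neg-distribˡ-* (sgn m) (sgn j))

r^k*k! : ℕ → ℕ → ℤ
r^k*k! r k = + (r ^ k ℕ.* k !)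

r^k*k!-suc : ∀ r k → r^k*k! r (suc k) ≡ + r * (+ suc k * r^k*k! r k)
r^k*k!-suc r k = begin
  + (r ^ suc k ℕ.* suc k !)              ≡⟨ cong +_ (rearrange r (suc k) (r ^ k) (k !)) ⟩
  + (r ℕ.* (suc k ℕ.* (r ^ k ℕ.* k !)))  ≡⟨ ℤP.pos-* r (suc k ℕ.* (r ^ k ℕ.* k !)) ⟩
  + r * + (suc k ℕ.* (r ^ k ℕ.* k !))    ≡⟨ cong (+ r *_) (ℤP.pos-* (suc k) (r ^ k ℕ.* k !)) ⟩
  + r * (+ suc k * r^k*k! r k)           ∎
  where
  open ≡-Reasoning
  rearrange : ∀ r n x y → r ℕ.* x ℕ.* (n ℕ.* y) ≡ r ℕ.* (n ℕ.* (x ℕ.* y))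
  rearrange = ℕ-solve-∀

module Moments (r : ℕ) (d : ℕ → ℤ) (recurrence : DerangementRecurrence r d) where

  -- L K j h is ℒ(yʲ h) for polynomials h of degree < K, where ℒ(yᵐ) = d m.
  L : ℕ → ℕ → Poly → ℤ
  L K j h = pairing K h (λ m → d (m ℕ.+ j))

  d-zero : d 0 ≡ 1ℤ
  d-zero = trans (recurrence 0) (cong (_+ 1ℤ) (ℤP.*-zeroʳ (+ r)))

  L-expand : ∀ K j {h} → h K ≡ 0ℤ →
    L K j h ≡ + r * L K j (∂ h) + + r * (+ j * pairing K h (λ m → d (ℕ.pred (m ℕ.+ j)))) + sgn j * at-1 K h
  L-expand K j {h} h_K≡0 = begin
    L K j h
      ≡⟨ sum-cong-≗ {K} (λ m → split (toℕ m)) ⟩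
    ∑[ m < K ] (A (toℕ m) + B (toℕ m) + C (toℕ m))
      ≡⟨ ∑-distrib-+ {K} (λ m → A (toℕ m) + B (toℕ m)) (C ∘′ toℕ) ⟩
    ∑[ m < K ] (A (toℕ m) + B (toℕ m)) + ∑[ m < K ] C (toℕ m)
      ≡⟨ cong (_+ ∑[ m < K ] C (toℕ m)) (∑-distrib-+ {K} (A ∘′ toℕ) (B ∘′ toℕ)) ⟩
    ∑[ m < K ] A (toℕ m) + ∑[ m < K ] B (toℕ m) + ∑[ m < K ] C (toℕ m)
      ≡⟨ cong₂ _+_ (cong₂ _+_ ∑A ∑B) ∑C ⟩
    + r * L K j (∂ h) + + r * (+ j * pairing K h w) + sgn j * at-1 K h
      ∎
    where
    open ≡-Reasoning
    w : ℕ → ℤ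
    w m = d (ℕ.pred (m ℕ.+ j))
    A B C : ℕ → ℤ
    A m = + r * (+ m * h m * w m)
    B m = + r * (+ j * (h m * w m))
    C m = sgn j * (h m * sgn m)
    split : ∀ m → h m * d (m ℕ.+ j) ≡ A m + B m + C m
    split m = begin
      h m * d (m ℕ.+ j)                                  ≡⟨ cong (h m *_) (recurrence (m ℕ.+ j)) ⟩
      h m * (+ r * (+ (m ℕ.+ j) * w m) + sgn (m ℕ.+ j))
        ≡⟨ cong₂ (λ x y → h m * (+ r * (x * w m) + y)) (ℤP.pos-+ m j) (sgn-+ m j) ⟩
      h m * (+ r * ((+ m + + j) * w m) + sgn m * sgn j)  ≡⟨ rearrange (h m) (+ r) (+ m) (+ j) (w m) (sgn m) (sgn j) ⟩
      A m + B m + C m                                    ∎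
      where
      rearrange : ∀ h r m j e s t →
                  h * (r * ((m + j) * e) + s * t) ≡ r * (m * h * e) + r * (j * (h * e)) + t * (h * s)
      rearrange = solve-∀
    ∑A : ∑[ m < K ] A (toℕ m) ≡ + r * L K j (∂ h)
    ∑A = trans (sym (*-distribˡ-sum {K} (+ r) (λ m → + toℕ m * h (toℕ m) * w (toℕ m))))
               (cong (+ r *_) (∑-shift K (λ m → + m * h m * w m) refl
                                 (trans (cong (λ x → + K * x * w K) h_K≡0) (cong (_* w K) (ℤP.*-zeroʳ (+ K))))))
    ∑B : ∑[ m < K ] B (toℕ m) ≡ + r * (+ j * pairing K h w)
    ∑B = trans (sym (*-distribˡ-sum {K} (+ r) (λ m → + j * (h (toℕ m) * w (toℕ m)))))
               (cong (+ r *_) (sym (*-distribˡ-sum {K} (+ j) (λ m → h (toℕ m) * w (toℕ m)))))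
    ∑C : ∑[ m < K ] C (toℕ m) ≡ sgn j * at-1 K h
    ∑C = sym (*-distribˡ-sum {K} (sgn j) (λ m → h (toℕ m) * sgn (toℕ m)))

  L-zero-expand : ∀ K {h} → h K ≡ 0ℤ → L K 0 h ≡ + r * L K 0 (∂ h) + at-1 K h
  L-zero-expand K {h} h_K≡0 = begin
    L K 0 h                                       ≡⟨ L-expand K 0 {h} h_K≡0 ⟩
    + r * L K 0 (∂ h) + + r * 0ℤ + 1ℤ * at-1 K h  ≡⟨ cong (λ x → + r * L K 0 (∂ h) + x + 1ℤ * at-1 K h) (ℤP.*-zeroʳ (+ r)) ⟩
    + r * L K 0 (∂ h) + 0ℤ + 1ℤ * at-1 K h        ≡⟨ simplify (+ r * L K 0 (∂ h)) (at-1 K h) ⟩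
    + r * L K 0 (∂ h) + at-1 K h                  ∎
    where
    open ≡-Reasoning
    simplify : ∀ a e → a + 0ℤ + 1ℤ * e ≡ a + e
    simplify = solve-∀

  L-T : ∀ K j {h} → h K ≡ 0ℤ →
    L K j (T r h) ≡ + r * (+ j * pairing K h (λ m → d (ℕ.pred (m ℕ.+ j)))) + sgn j * at-1 K h
  L-T K j {h} h_K≡0 = begin
    L K j (T r h)                                  ≡⟨ pairing-linear K h (∂ h) (+ r) (λ m → d (m ℕ.+ j)) ⟩
    L K j h - + r * L K j (∂ h)                    ≡⟨ cong (_- + r * L K j (∂ h)) (L-expand K j {h} h_K≡0) ⟩
    + r * L K j (∂ h) + B + C - + r * L K j (∂ h)  ≡⟨ cancel (+ r * L K j (∂ h)) B C ⟩
    B + C                                          ∎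
    where
    open ≡-Reasoning
    B C : ℤ
    B = + r * (+ j * pairing K h (λ m → d (ℕ.pred (m ℕ.+ j))))
    C = sgn j * at-1 K h
    cancel : ∀ a b c → a + b + c - a ≡ b + c
    cancel = solve-∀

  L-T-zero : ∀ K {h} → h K ≡ 0ℤ → L K 0 (T r h) ≡ at-1 K h
  L-T-zero K {h} h_K≡0 = begin
    L K 0 (T r h)             ≡⟨ L-T K 0 {h} h_K≡0 ⟩
    + r * 0ℤ + 1ℤ * at-1 K h  ≡⟨ cong (_+ 1ℤ * at-1 K h) (ℤP.*-zeroʳ (+ r)) ⟩
    0ℤ + 1ℤ * at-1 K h        ≡⟨ trans (ℤP.+-identityˡ (1ℤ * at-1 K h)) (ℤP.*-identityˡ (at-1 K h)) ⟩
    at-1 K h                  ∎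
    where open ≡-Reasoning

  L-T-suc : ∀ K j {h} → h K ≡ 0ℤ → L K (suc j) (T r h) ≡ + r * (+ suc j * L K j h) + sgn (suc j) * at-1 K h
  L-T-suc K j {h} h_K≡0 = trans (L-T K (suc j) {h} h_K≡0)
    (cong (λ x → + r * (+ suc j * x) + sgn (suc j) * at-1 K h)
          (sum-cong-≗ {K} (λ m → cong (λ n → h (toℕ m) * d (ℕ.pred n)) (ℕP.+-suc (toℕ m) j))))

  L-binomial : ∀ {K} k → k < K → L K 0 (binomial k) ≡ r^k*k! r k
  L-binomial {suc K} zero    _   = begin
    1ℤ * d 0 + ∑[ m < K ] (0ℤ * d (suc (toℕ m) ℕ.+ 0))  ≡⟨ cong₂ _+_ (ℤP.*-identityˡ (d 0)) (∑-zero {K} (λ _ → refl)) ⟩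
    d 0 + 0ℤ                                             ≡⟨ trans (ℤP.+-identityʳ (d 0)) d-zero ⟩
    1ℤ                                                   ∎
    where open ≡-Reasoning
  L-binomial {K} (suc k) k<K = begin
    L K 0 (binomial (suc k))
      ≡⟨ L-zero-expand K {binomial (suc k)} (binomial-degree (suc k) k<K) ⟩
    + r * L K 0 (∂ (binomial (suc k))) + at-1 K (binomial (suc k))
      ≡⟨ cong₂ (λ x y → + r * x + y) L∂ (at-1-T^-binomial r 0 (s≤s z≤n) k<K) ⟩
    + r * (+ suc k * L K 0 (binomial k)) + 0ℤ
      ≡⟨ ℤP.+-identityʳ _ ⟩
    + r * (+ suc k * L K 0 (binomial k))
      ≡⟨ cong (λ x → + r * (+ suc k * x)) (L-binomial k (ℕP.<-trans (ℕP.n<1+n k) k<K)) ⟩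
    + r * (+ suc k * r^k*k! r k)
      ≡⟨ r^k*k!-suc r k ⟨
    r^k*k! r (suc k)
      ∎
    where
    open ≡-Reasoning
    L∂ : L K 0 (∂ (binomial (suc k))) ≡ + suc k * L K 0 (binomial k)
    L∂ = trans (pairing-cong K (λ m → d (m ℕ.+ 0)) (∂-binomial k))
               (pairing-scale K (+ suc k) (binomial k) (λ m → d (m ℕ.+ 0)))

  module _ {K : ℕ} {h : Poly} (deg : Degree< K h) where

    private
      vanishes-at-K : ∀ i → T^ r i h K ≡ 0ℤ
      vanishes-at-K i = T^-degree r i deg ℕP.≤-refl

    L-T^-below : ∀ i → (∀ {l} → l < i → at-1 K (T^ r l h) ≡ 0ℤ) → ∀ {j} → j < i → L K j (T^ r i h) ≡ 0ℤ
    L-T^-below (suc i) at-1≡0 {zero}  _         =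
      trans (L-T-zero K {T^ r i h} (vanishes-at-K i)) (at-1≡0 (ℕP.n<1+n i))
    L-T^-below (suc i) at-1≡0 {suc j} (s≤s j<i) = begin
      L K (suc j) (T r (T^ r i h))
        ≡⟨ L-T-suc K j {T^ r i h} (vanishes-at-K i) ⟩
      + r * (+ suc j * L K j (T^ r i h)) + sgn (suc j) * at-1 K (T^ r i h)
        ≡⟨ cong₂ (λ x y → + r * (+ suc j * x) + sgn (suc j) * y)
                 (L-T^-below i (λ l<i → at-1≡0 (ℕP.m<n⇒m<1+n l<i)) j<i) (at-1≡0 (ℕP.n<1+n i)) ⟩
      + r * (+ suc j * 0ℤ) + sgn (suc j) * 0ℤ
        ≡⟨ vanish (+ r) (+ suc j) (sgn (suc j)) ⟩
      0ℤ
        ∎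
      where
      open ≡-Reasoning
      vanish : ∀ r n s → r * (n * 0ℤ) + s * 0ℤ ≡ 0ℤ
      vanish = solve-∀

    L-T^-diagonal : ∀ i → (∀ {l} → l < i → at-1 K (T^ r l h) ≡ 0ℤ) → L K i (T^ r i h) ≡ r^k*k! r i * L K 0 h
    L-T^-diagonal zero    _      = sym (ℤP.*-identityˡ (L K 0 h))
    L-T^-diagonal (suc i) at-1≡0 = begin
      L K (suc i) (T r (T^ r i h))
        ≡⟨ L-T-suc K i {T^ r i h} (vanishes-at-K i) ⟩
      + r * (+ suc i * L K i (T^ r i h)) + sgn (suc i) * at-1 K (T^ r i h)
        ≡⟨ cong₂ (λ x y → + r * (+ suc i * x) + sgn (suc i) * y)
                 (L-T^-diagonal i (λ l<i → at-1≡0 (ℕP.m<n⇒m<1+n l<i))) (at-1≡0 (ℕP.n<1+n i)) ⟩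
      + r * (+ suc i * (r^k*k! r i * L K 0 h)) + sgn (suc i) * 0ℤ
        ≡⟨ rearrange (+ r) (+ suc i) (r^k*k! r i) (L K 0 h) (sgn (suc i)) ⟩
      + r * (+ suc i * r^k*k! r i) * L K 0 h
        ≡⟨ cong (_* L K 0 h) (r^k*k!-suc r i) ⟨
      r^k*k! r (suc i) * L K 0 h
        ∎
      where
      open ≡-Reasoning
      rearrange : ∀ r n x l s → r * (n * (x * l)) + s * 0ℤ ≡ r * (n * x) * l
      rearrange = solve-∀

-- The Hankel determinant

module _ {r : ℕ} {d : ℕ → ℤ} (recurrence : DerangementRecurrence r d) (n : ℕ) where

  open Moments r d recurrence

  hankel : Matrix (suc n)
  hankel i j = d (toℕ i ℕ.+ toℕ j)

  orthogonalPolys : Matrix (suc n)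
  orthogonalPolys a b = T^ r (toℕ a) (binomial (toℕ a)) (toℕ b)

  orthogonalPolys-unitLowerTriangular : UnitLowerTriangular orthogonalPolys
  orthogonalPolys-unitLowerTriangular =
      (λ a → trans (T^-top r (toℕ a) (binomial-degree (toℕ a))) (binomial-top (toℕ a)))
    , (λ {a} a<b → T^-degree r (toℕ a) (binomial-degree (toℕ a)) a<b)

  private
    module _ (a : Fin (suc n)) where
      deg : Degree< (suc n) (binomial (toℕ a))
      deg = Degree<-weaken (FinP.toℕ<n a) (binomial-degree (toℕ a))
      at-1≡0 : ∀ {l} → l < toℕ a → at-1 (suc n) (T^ r l (binomial (toℕ a))) ≡ 0ℤ
      at-1≡0 {l} l<a = at-1-T^-binomial r l l<a (FinP.toℕ<n a)

  orthogonalPolys·hankel-upperTriangular : UpperTriangular (orthogonalPolys · hankel)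
  orthogonalPolys·hankel-upperTriangular {a} b<a = L-T^-below (deg a) (toℕ a) (at-1≡0 a) b<a

  orthogonalPolys·hankel-diagonal : ∀ a → (orthogonalPolys · hankel) a a ≡ r^k*k! r (toℕ a) * r^k*k! r (toℕ a)
  orthogonalPolys·hankel-diagonal a =
    trans (L-T^-diagonal (deg a) (toℕ a) (at-1≡0 a)) (cong (r^k*k! r (toℕ a) *_) (L-binomial (toℕ a) (FinP.toℕ<n a)))

  det-hankel : det (suc n) hankel ≡ product {suc n} (λ a → r^k*k! r (toℕ a) * r^k*k! r (toℕ a))
  det-hankel = begin
    det (suc n) hankel
      ≡⟨ det-unitLowerTriangular-· (suc n) orthogonalPolys-unitLowerTriangular hankel ⟨
    det (suc n) (orthogonalPolys · hankel)
      ≡⟨ det-upperTriangular (suc n) (orthogonalPolys · hankel) orthogonalPolys·hankel-upperTriangular ⟩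
    product (λ a → (orthogonalPolys · hankel) a a)
      ≡⟨ product-cong {suc n} {λ a → (orthogonalPolys · hankel) a a} {λ a → r^k*k! r (toℕ a) * r^k*k! r (toℕ a)}
                      orthogonalPolys·hankel-diagonal ⟩
    product {suc n} (λ a → r^k*k! r (toℕ a) * r^k*k! r (toℕ a))
      ∎
    where open ≡-Reasoning

product-r^k*k!² : ∀ r n → product {suc n} (λ a → r^k*k! r (toℕ a) * r^k*k! r (toℕ a))
                          ≡ + (r ^ (n ℕ.* suc n) ℕ.* (superfact n ℕ.* superfact n))
product-r^k*k!² r zero    = refl
product-r^k*k!² r (suc n) = begin
  product {suc (suc n)} (λ a → r^k*k! r (toℕ a) * r^k*k! r (toℕ a))
    ≡⟨ sum-toℕ-last ℤP.*-1-monoid (suc n) (λ k → r^k*k! r k * r^k*k! r k) ⟩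
  product {suc n} (λ a → r^k*k! r (toℕ a) * r^k*k! r (toℕ a)) * (r^k*k! r (suc n) * r^k*k! r (suc n))
    ≡⟨ cong (_* (r^k*k! r (suc n) * r^k*k! r (suc n))) (product-r^k*k!² r n) ⟩
  + (X ℕ.* (S ℕ.* S)) * (+ (Y ℕ.* F) * + (Y ℕ.* F))
    ≡⟨ cong (+ (X ℕ.* (S ℕ.* S)) *_) (ℤP.pos-* (Y ℕ.* F) (Y ℕ.* F)) ⟨
  + (X ℕ.* (S ℕ.* S)) * + (Y ℕ.* F ℕ.* (Y ℕ.* F))
    ≡⟨ ℤP.pos-* (X ℕ.* (S ℕ.* S)) (Y ℕ.* F ℕ.* (Y ℕ.* F)) ⟨
  + (X ℕ.* (S ℕ.* S) ℕ.* (Y ℕ.* F ℕ.* (Y ℕ.* F)))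
    ≡⟨ cong +_ (rearrange X Y S F) ⟩
  + (X ℕ.* (Y ℕ.* Y) ℕ.* (S ℕ.* F ℕ.* (S ℕ.* F)))
    ≡⟨ cong (λ e → + (e ℕ.* (S ℕ.* F ℕ.* (S ℕ.* F)))) exponent ⟨
  + (r ^ (suc n ℕ.* suc (suc n)) ℕ.* (superfact (suc n) ℕ.* superfact (suc n)))
    ∎
  where
  open ≡-Reasoning
  X Y S F : ℕ
  X = r ^ (n ℕ.* suc n)
  Y = r ^ suc n
  S = superfact n
  F = suc n !
  rearrange : ∀ X Y S F →
              X ℕ.* (S ℕ.* S) ℕ.* (Y ℕ.* F ℕ.* (Y ℕ.* F)) ≡ X ℕ.* (Y ℕ.* Y) ℕ.* (S ℕ.* F ℕ.* (S ℕ.* F))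
  rearrange = ℕ-solve-∀
  exponent : r ^ (suc n ℕ.* suc (suc n)) ≡ X ℕ.* (Y ℕ.* Y)
  exponent = begin
    r ^ (suc n ℕ.* suc (suc n))              ≡⟨ cong (r ^_) (split n) ⟩
    r ^ (n ℕ.* suc n ℕ.+ (suc n ℕ.+ suc n))  ≡⟨ ℕP.^-distribˡ-+-* r (n ℕ.* suc n) (suc n ℕ.+ suc n) ⟩
    X ℕ.* r ^ (suc n ℕ.+ suc n)              ≡⟨ cong (X ℕ.*_) (ℕP.^-distribˡ-+-* r (suc n) (suc n)) ⟩
    X ℕ.* (Y ℕ.* Y)                          ∎
    where
    split : ∀ n → suc n ℕ.* suc (suc n) ≡ n ℕ.* suc n ℕ.+ (suc n ℕ.+ suc n)
    split = ℕ-solve-∀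

corollary18 : (r : ℕ) → r ≥ 1 → (d : ℕ → ℤ) → HasEGF r d →
    (n : ℕ) →
      det (suc n) (λ i j → d (toℕ i ℕ.+ toℕ j))
        ≡ + (r ^ (n ℕ.* suc n) ℕ.* (superfact n ℕ.* superfact n))
corollary18 r _ d egf n = begin
  det (suc n) (λ i j → d (toℕ i ℕ.+ toℕ j))
    ≡⟨ det-hankel {r} {d} (HasEGF⇒recurrence {r} {d} egf) n ⟩
  product {suc n} (λ a → r^k*k! r (toℕ a) * r^k*k! r (toℕ a))
    ≡⟨ product-r^k*k!² r n ⟩
  + (r ^ (n ℕ.* suc n) ℕ.* (superfact n ℕ.* superfact n))
    ∎
  where open ≡-Reasoning
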